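{- Let $\mathcal{M}^c=\langle S^c,N^c,V^c\rangle$ be the canonical model for $\mathbf{M}^\Delta$ and $(N^c)^+$ the superset closure of $N^c$. Then for each $s\in S^c$ and each formula $\phi$: $|\phi|\in(N^c)^+(s)$ iff $\Delta(\phi\vee\psi)\in s$ for every formula $\psi$.
   Context: $\mathcal{L}(\Delta)$: $\phi::=p\mid\neg\phi\mid\phi\land\phi\mid\Delta\phi$, $p$ in a countable set $\mathbf{P}$. $\mathbf{M}^\Delta$ is axiomatized by all propositional tautologies, $\Delta\phi\leftrightarrow\Delta\neg\phi$, $\Delta\phi\to\Delta(\phi\vee\psi)\vee\Delta(\neg\phi\vee\chi)$, modus ponens, and RE$\Delta$ (from $\phi\leftrightarrow\psi$ infer $\Delta\phi\leftrightarrow\Delta\psi$). Canonical model: $S^c$ is the set of maximal $\mathbf{M}^\Delta$-consistent sets; $|\phi|=\{s\in S^c\mid\phi\in s\}$; $N^c(s)=\{|\phi|\mid\Delta(\phi\vee\psi)\in s\text{ for every formula }\psi\}$; $V^c(p)=|p|$. Supplementation: $(N^c)^+(s)=\{X\subseteq S^c\mid Y\subseteq X\text{ for some }Y\in N^c(s)\}$. -}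

module Defs where

open import Data.Nat using (ℕ)
open import Data.Bool using (Bool; true; false; not; _∧_)
open import Data.List using (List; []; _∷_)
open import Data.List.Relation.Unary.All using (All)
open import Data.Product using (Σ; ∃; _×_; _,_)
open import Relation.Binary.PropositionalEquality using (_≡_)
open import Relation.Nullary using (¬_)
open import Level using (Level; 0ℓ) renaming (suc to lsuc)

infixr 6 _∧′_
infixr 5 _∨′_
infixr 4 _⇒′_

data Formula : Set where
  var  : ℕ → Formula
  ¬′_  : Formula → Formula
  _∧′_ : Formula → Formula → Formula
  Δ    : Formula → Formula

_∨′_ : Formula → Formula → Formula
φ ∨′ ψ = ¬′ (¬′ φ ∧′ ¬′ ψ)

_⇒′_ : Formula → Formula → Formula
φ ⇒′ ψ = ¬′ (φ ∧′ ¬′ ψ)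

_⇔′_ : Formula → Formula → Formula
φ ⇔′ ψ = (φ ⇒′ ψ) ∧′ (ψ ⇒′ φ)

⊤′ : Formula
⊤′ = ¬′ (var 0 ∧′ ¬′ var 0)

-- Propositional evaluation: atoms are the variables and the Δ-formulas.
eval : (Formula → Bool) → Formula → Bool
eval v (var p)  = v (var p)
eval v (¬′ φ)   = not (eval v φ)
eval v (φ ∧′ ψ) = eval v φ ∧ eval v ψ
eval v (Δ φ)    = v (Δ φ)

-- Propositional tautology (substitution instance of a tautology)
Tautology : Formula → Set
Tautology φ = (v : Formula → Bool) → eval v φ ≡ true

data ⊢_ : Formula → Set where
  taut  : ∀ {φ} → Tautology φ → ⊢ φ
  ax-Δ¬ : ∀ {φ} → ⊢ (Δ φ ⇔′ Δ (¬′ φ))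
  ax-M  : ∀ {φ ψ χ} → ⊢ (Δ φ ⇒′ (Δ (φ ∨′ ψ) ∨′ Δ (¬′ φ ∨′ χ)))
  mp    : ∀ {φ ψ} → ⊢ φ → ⊢ (φ ⇒′ ψ) → ⊢ ψ
  reΔ   : ∀ {φ ψ} → ⊢ (φ ⇔′ ψ) → ⊢ (Δ φ ⇔′ Δ ψ)

FSet : Set₁
FSet = Formula → Set

⋀ : List Formula → Formula
⋀ []       = ⊤′
⋀ (φ ∷ φs) = φ ∧′ ⋀ φs

Consistent : FSet → Set
Consistent Γ = ¬ (Σ (List Formula) λ L → All Γ L × (⊢ ¬′ ⋀ L))

MaximalConsistent : FSet → Set₁
MaximalConsistent Γ =
  Consistent Γ × ((Γ′ : FSet) → (∀ φ → Γ φ → Γ′ φ) → Consistent Γ′ → ∀ φ → Γ′ φ → Γ φ)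

Sᶜ : Set₁
Sᶜ = Σ FSet MaximalConsistent

_∈ₛ_ : Formula → Sᶜ → Set
φ ∈ₛ (Γ , _) = Γ φ

SubSᶜ : Set₁
SubSᶜ = Sᶜ → Set

∣_∣ : Formula → SubSᶜ
∣ φ ∣ s = φ ∈ₛ s

_⊆ₛ_ : SubSᶜ → SubSᶜ → Set₁
X ⊆ₛ Y = ∀ t → X t → Y t

_≐ₛ_ : SubSᶜ → SubSᶜ → Set₁
X ≐ₛ Y = (X ⊆ₛ Y) × (Y ⊆ₛ X)

Nᶜ : Sᶜ → SubSᶜ → Set₁
Nᶜ s X = Σ Formula λ φ → (X ≐ₛ ∣ φ ∣) × (∀ ψ → Δ (φ ∨′ ψ) ∈ₛ s)

Nᶜ⁺ : Sᶜ → SubSᶜ → Set₁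
Nᶜ⁺ s X = Σ SubSᶜ λ Y → Nᶜ s Y × (Y ⊆ₛ X)

-- Only the left-to-right direction has content. Suppose |χ| ⊆ |φ| and Δ(χ ∨ θ) ∈ s for every θ.
-- Then ⊢ χ → φ: otherwise χ ∧ ¬φ is consistent, and Lindenbaum's lemma (an enumeration of the
-- formulas plus excluded middle) puts it into a maximal consistent set lying in |χ| but not in |φ|.
-- Hence ⊢ χ ∨ (φ ∨ ψ) ↔ φ ∨ ψ, so RE∆ makes Δ(χ ∨ (φ ∨ ψ)) and Δ(φ ∨ ψ) provably equivalent,
-- and the instance θ = φ ∨ ψ of the hypothesis puts Δ(φ ∨ ψ) into s.
module Submission where

open import Defs
open import Level using (Level; 0ℓ)
open import Axiom.ExcludedMiddle using (ExcludedMiddle)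
open import Data.Bool using (Bool; true; false; not; _∧_)
open import Data.Empty using (⊥-elim)
open import Data.List using (List; []; _∷_; _++_; map; foldl; cartesianProductWith)
open import Data.List.Membership.Propositional using (_∈_)
open import Data.List.Membership.Propositional.Properties
  using (∈-map⁺; ∈-++⁺ˡ; ∈-++⁺ʳ; ∈-cartesianProductWith⁺)
open import Data.List.Relation.Unary.All using (All; []; _∷_)
import Data.List.Relation.Unary.All as All
open import Data.List.Relation.Unary.All.Properties using (++⁺; ++⁻)
open import Data.List.Relation.Unary.Any using (here; there)
open import Data.Nat using (ℕ; zero; suc; _≤_; _⊔_; _≤′_; ≤′-refl; ≤′-step)
open import Data.Nat.Properties using (m≤m⊔n; m≤n⊔m; ≤⇒≤′)
open import Data.Product using (Σ; ∃; _×_; _,_; proj₁; proj₂)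
open import Data.Sum using (_⊎_; inj₁; inj₂)
open import Relation.Binary.PropositionalEquality using (_≡_; refl; cong; cong₂)
open import Relation.Nullary using (Dec; yes; no; ¬_)
open import Relation.Unary using (Pred; _⊆_; ∅; ｛_｝; _∪_; ⋃)

infix 3.5 _⊨_

-- A record rather than eval v φ ≡ true, so that φ stays inferable (eval is not injective).
record _⊨_ (v : Formula → Bool) (φ : Formula) : Set where
  constructor holds
  field evaluates-true : eval v φ ≡ true

module _ {v : Formula → Bool} where

  ⊨-¬⁺ : ∀ {φ} → ¬ v ⊨ φ → v ⊨ ¬′ φ
  ⊨-¬⁺ {φ} ⊭φ with eval v φ in e
  ... | true  = ⊥-elim (⊭φ (holds e))
  ... | false = holds (cong not e)

  ⊨-¬⁻ : ∀ {φ} → v ⊨ ¬′ φ → ¬ v ⊨ φ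
  ⊨-¬⁻ {φ} (holds ⊨¬φ) (holds ⊨φ) with eval v φ
  ⊨-¬⁻ (holds ()) _ | true
  ⊨-¬⁻ _ (holds ()) | false

  ⊨-stable : ∀ {φ} → ¬ ¬ v ⊨ φ → v ⊨ φ
  ⊨-stable {φ} ¬⊭φ with eval v φ in e
  ... | true  = holds e
  ... | false = ⊥-elim (¬⊭φ (⊨-¬⁻ (holds (cong not e))))

  ⊨-∧⁺ : ∀ {φ ψ} → v ⊨ φ → v ⊨ ψ → v ⊨ φ ∧′ ψ
  ⊨-∧⁺ (holds ⊨φ) (holds ⊨ψ) = holds (cong₂ _∧_ ⊨φ ⊨ψ)

  ⊨-∧⁻ : ∀ {φ ψ} → v ⊨ φ ∧′ ψ → v ⊨ φ × v ⊨ ψ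
  ⊨-∧⁻ {φ} {ψ} (holds ⊨φ∧ψ) with eval v φ in eφ | eval v ψ in eψ
  ⊨-∧⁻ _            | true  | true  = holds eφ , holds eψ
  ⊨-∧⁻ (holds ())   | true  | false
  ⊨-∧⁻ (holds ())   | false | _

  ⊨-⇒⁺ : ∀ {φ ψ} → (v ⊨ φ → v ⊨ ψ) → v ⊨ φ ⇒′ ψ
  ⊨-⇒⁺ φ→ψ = ⊨-¬⁺ λ ⊨φ∧¬ψ → let (⊨φ , ⊨¬ψ) = ⊨-∧⁻ ⊨φ∧¬ψ in ⊨-¬⁻ ⊨¬ψ (φ→ψ ⊨φ)

  ⊨-⇒⁻ : ∀ {φ ψ} → v ⊨ φ ⇒′ ψ → v ⊨ φ → v ⊨ ψ
  ⊨-⇒⁻ ⊨φ⇒ψ ⊨φ = ⊨-stable λ ⊭ψ → ⊨-¬⁻ ⊨φ⇒ψ (⊨-∧⁺ ⊨φ (⊨-¬⁺ ⊭ψ))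

  ⊨-⋀⁺ : ∀ {L} → All (v ⊨_) L → v ⊨ ⋀ L
  ⊨-⋀⁺ []         = ⊨-⇒⁺ λ ⊨p → ⊨p
  ⊨-⋀⁺ (⊨φ ∷ ⊨L) = ⊨-∧⁺ ⊨φ (⊨-⋀⁺ ⊨L)

  ⊨-⋀⁻ : ∀ L → v ⊨ ⋀ L → All (v ⊨_) L
  ⊨-⋀⁻ []      _     = []
  ⊨-⋀⁻ (_ ∷ L) ⊨φ∧L = let (⊨φ , ⊨L) = ⊨-∧⁻ ⊨φ∧L in ⊨φ ∷ ⊨-⋀⁻ L ⊨L

⊢-⇒-taut : ∀ {φ ψ} → (∀ v → v ⊨ φ → v ⊨ ψ) → ⊢ (φ ⇒′ ψ)
⊢-⇒-taut φ⊨ψ = taut λ v → _⊨_.evaluates-true (⊨-⇒⁺ (φ⊨ψ v))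

⊢-by-taut : ∀ {φ ψ} → ⊢ φ → (∀ v → v ⊨ φ → v ⊨ ψ) → ⊢ ψ
⊢-by-taut ⊢φ φ⊨ψ = mp ⊢φ (⊢-⇒-taut φ⊨ψ)

⊢-by-taut₂ : ∀ {φ ψ χ} → ⊢ φ → ⊢ ψ → (∀ v → v ⊨ φ → v ⊨ ψ → v ⊨ χ) → ⊢ χ
⊢-by-taut₂ ⊢φ ⊢ψ φψ⊨χ = mp ⊢ψ (mp ⊢φ (⊢-⇒-taut λ v ⊨φ → ⊨-⇒⁺ (φψ⊨χ v ⊨φ)))

⊢-⇔⇒⇒ : ∀ {φ ψ} → ⊢ (φ ⇔′ ψ) → ⊢ (φ ⇒′ ψ)
⊢-⇔⇒⇒ ⊢φ⇔ψ = ⊢-by-taut ⊢φ⇔ψ λ _ ⊨φ⇔ψ → proj₁ (⊨-∧⁻ ⊨φ⇔ψ)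

⊢-∨-absorb : ∀ {χ φ ψ} → ⊢ (χ ⇒′ φ) → ⊢ ((χ ∨′ (φ ∨′ ψ)) ⇔′ (φ ∨′ ψ))
⊢-∨-absorb {χ} {φ} {ψ} ⊢χ⇒φ = ⊢-by-taut ⊢χ⇒φ λ v (holds χ⇒φ) → holds (absorb v χ⇒φ)
  where
  absorb : ∀ v → eval v (χ ⇒′ φ) ≡ true → eval v ((χ ∨′ (φ ∨′ ψ)) ⇔′ (φ ∨′ ψ)) ≡ true
  absorb v χ⇒φ with eval v χ | eval v φ | eval v ψ
  absorb v () | true  | false | _
  ... | true  | true  | _     = refl
  ... | false | true  | _     = refl
  ... | false | false | true  = refl
  ... | false | false | false = refl

Inconsistent : FSet → Set
Inconsistent Γ = Σ (List Formula) λ L → All Γ L × (⊢ (¬′ ⋀ L))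

infix 3 _⊢ᶠ_

_⊢ᶠ_ : FSet → Formula → Set
Γ ⊢ᶠ φ = Σ (List Formula) λ L → All Γ L × (⊢ (⋀ L ⇒′ φ))

⊢ᶠ-assumption : ∀ {Γ : FSet} {φ} → Γ φ → Γ ⊢ᶠ φ
⊢ᶠ-assumption {φ = φ} Γφ = φ ∷ [] , Γφ ∷ [] , ⊢-⇒-taut λ _ ⊨φ∧⊤ → proj₁ (⊨-∧⁻ ⊨φ∧⊤)

⊢ᶠ-mp : ∀ {Γ : FSet} {φ ψ} → Γ ⊢ᶠ φ → ⊢ (φ ⇒′ ψ) → Γ ⊢ᶠ ψ
⊢ᶠ-mp (L , ΓL , ⊢L⇒φ) ⊢φ⇒ψ =
  L , ΓL , ⊢-by-taut₂ ⊢L⇒φ ⊢φ⇒ψ λ _ ⊨L⇒φ ⊨φ⇒ψ → ⊨-⇒⁺ λ ⊨L → ⊨-⇒⁻ ⊨φ⇒ψ (⊨-⇒⁻ ⊨L⇒φ ⊨L)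

⊢ᶠ-contradiction : ∀ {Γ : FSet} {φ} → Γ ⊢ᶠ φ → Γ ⊢ᶠ ¬′ φ → Inconsistent Γ
⊢ᶠ-contradiction (L₁ , ΓL₁ , ⊢L₁⇒φ) (L₂ , ΓL₂ , ⊢L₂⇒¬φ) =
  L₁ ++ L₂ , ++⁺ ΓL₁ ΓL₂ , ⊢-by-taut₂ ⊢L₁⇒φ ⊢L₂⇒¬φ λ _ ⊨L₁⇒φ ⊨L₂⇒¬φ → ⊨-¬⁺ λ ⊨L₁L₂ →
    let (⊨L₁ , ⊨L₂) = ++⁻ L₁ (⊨-⋀⁻ (L₁ ++ L₂) ⊨L₁L₂)
    in ⊨-¬⁻ (⊨-⇒⁻ ⊨L₂⇒¬φ (⊨-⋀⁺ ⊨L₂)) (⊨-⇒⁻ ⊨L₁⇒φ (⊨-⋀⁺ ⊨L₁))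

⊢ᶠ-∅ : ∀ {φ} → ∅ ⊢ᶠ φ → ⊢ φ
⊢ᶠ-∅ ([] , [] , ⊢⊤⇒φ) = ⊢-by-taut ⊢⊤⇒φ λ _ ⊨⊤⇒φ → ⊨-⇒⁻ ⊨⊤⇒φ (⊨-⋀⁺ [])

All-∪-｛｝⁻ : ∀ {Γ : FSet} {φ} L → All (Γ ∪ ｛ φ ｝) L →
  Σ (List Formula) λ L′ → All Γ L′ × (∀ v → v ⊨ φ → All (v ⊨_) L′ → All (v ⊨_) L)
All-∪-｛｝⁻ [] [] = [] , [] , λ _ _ _ → []
All-∪-｛｝⁻ (ψ ∷ L) (inj₁ Γψ ∷ ΓφL) =
  let (L′ , ΓL′ , φL′⊨L) = All-∪-｛｝⁻ L ΓφL
  in ψ ∷ L′ , Γψ ∷ ΓL′ , λ { v ⊨φ (⊨ψ ∷ ⊨L′) → ⊨ψ ∷ φL′⊨L v ⊨φ ⊨L′ }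
All-∪-｛｝⁻ (ψ ∷ L) (inj₂ refl ∷ ΓφL) =
  let (L′ , ΓL′ , φL′⊨L) = All-∪-｛｝⁻ L ΓφL
  in L′ , ΓL′ , λ v ⊨φ ⊨L′ → ⊨φ ∷ φL′⊨L v ⊨φ ⊨L′

deduction : ∀ {Γ : FSet} {φ} → Inconsistent (Γ ∪ ｛ φ ｝) → Γ ⊢ᶠ ¬′ φ
deduction (L , ΓφL , ⊢¬L) =
  let (L′ , ΓL′ , φL′⊨L) = All-∪-｛｝⁻ L ΓφL
  in L′ , ΓL′ , ⊢-by-taut ⊢¬L λ v ⊨¬L → ⊨-⇒⁺ λ ⊨L′ → ⊨-¬⁺ λ ⊨φ →
       ⊨-¬⁻ ⊨¬L (⊨-⋀⁺ (φL′⊨L v ⊨φ (⊨-⋀⁻ L′ ⊨L′)))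

Consistent-∪-¬ : ∀ {Γ : FSet} {φ} → Consistent Γ → ¬ Consistent (Γ ∪ ｛ φ ｝) → Consistent (Γ ∪ ｛ ¬′ φ ｝)
Consistent-∪-¬ conΓ ¬conΓφ incΓ¬φ =
  ¬conΓφ λ incΓφ → conΓ (⊢ᶠ-contradiction (deduction incΓφ) (deduction incΓ¬φ))

mcs-closed : ∀ (s : Sᶜ) {φ ψ} → φ ∈ₛ s → ⊢ (φ ⇒′ ψ) → ψ ∈ₛ s
mcs-closed (Γ , conΓ , maximal) {ψ = ψ} Γφ ⊢φ⇒ψ =
  maximal (Γ ∪ ｛ ψ ｝) (λ _ → inj₁) conΓψ ψ (inj₂ refl)
  where
  conΓψ : Consistent (Γ ∪ ｛ ψ ｝)
  conΓψ incΓψ = conΓ (⊢ᶠ-contradiction (⊢ᶠ-mp (⊢ᶠ-assumption Γφ) ⊢φ⇒ψ) (deduction incΓψ))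

⊆-suc⇒⊆-≤ : ∀ {a ℓ} {A : Set a} (P : ℕ → Pred A ℓ) →
  (∀ n → P n ⊆ P (suc n)) → ∀ {m n} → m ≤ n → P m ⊆ P n
⊆-suc⇒⊆-≤ P P⊆P-suc m≤n = ⊆-≤′ (≤⇒≤′ m≤n)
  where
  ⊆-≤′ : ∀ {m n} → m ≤′ n → P m ⊆ P n
  ⊆-≤′ ≤′-refl          = λ Pm → Pm
  ⊆-≤′ (≤′-step m≤′n) = λ Pm → P⊆P-suc _ (⊆-≤′ m≤′n Pm)

All-⋃-chain : ∀ (P : ℕ → FSet) → (∀ n → P n ⊆ P (suc n)) →
  ∀ L → All (⋃ ℕ P) L → ∃ λ N → All (P N) L
All-⋃-chain P P⊆P-suc []      []                = 0 , []
All-⋃-chain P P⊆P-suc (_ ∷ L) ((n , Pnφ) ∷ ⋃PL) =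
  let (N , PNL) = All-⋃-chain P P⊆P-suc L ⋃PL
  in n ⊔ N , mono (m≤m⊔n n N) Pnφ ∷ All.map (mono (m≤n⊔m n N)) PNL
  where mono = ⊆-suc⇒⊆-≤ P P⊆P-suc

⋃-chain-consistent : ∀ (P : ℕ → FSet) → (∀ n → P n ⊆ P (suc n)) →
  (∀ n → Consistent (P n)) → Consistent (⋃ ℕ P)
⋃-chain-consistent P P⊆P-suc conP (L , ⋃PL , ⊢¬L) =
  let (N , PNL) = All-⋃-chain P P⊆P-suc L ⋃PL in conP N (L , PNL , ⊢¬L)

formulasUpTo : ℕ → List Formula
formulasUpTo zero    = []
formulasUpTo (suc n) =
  let Φ = formulasUpTo n in var n ∷ (Φ ++ map ¬′_ Φ ++ map Δ Φ ++ cartesianProductWith _∧′_ Φ Φ)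

formulasUpTo-mono : ∀ {m n} → m ≤ n → (_∈ formulasUpTo m) ⊆ (_∈ formulasUpTo n)
formulasUpTo-mono = ⊆-suc⇒⊆-≤ (λ n → _∈ formulasUpTo n) λ _ φ∈ → there (∈-++⁺ˡ φ∈)

formulasUpTo-complete : ∀ φ → ∃ λ n → φ ∈ formulasUpTo n
formulasUpTo-complete (var p) = suc p , here refl
formulasUpTo-complete (¬′ φ) =
  let (n , φ∈) = formulasUpTo-complete φ ; Φ = formulasUpTo n
  in suc n , there (∈-++⁺ʳ Φ (∈-++⁺ˡ (∈-map⁺ ¬′_ φ∈)))
formulasUpTo-complete (Δ φ) =
  let (n , φ∈) = formulasUpTo-complete φ ; Φ = formulasUpTo n
  in suc n , there (∈-++⁺ʳ Φ (∈-++⁺ʳ (map ¬′_ Φ) (∈-++⁺ˡ (∈-map⁺ Δ φ∈))))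
formulasUpTo-complete (φ ∧′ ψ) =
  let (m , φ∈) = formulasUpTo-complete φ
      (n , ψ∈) = formulasUpTo-complete ψ
      Φ = formulasUpTo (m ⊔ n)
  in suc (m ⊔ n) , there (∈-++⁺ʳ Φ (∈-++⁺ʳ (map ¬′_ Φ) (∈-++⁺ʳ (map Δ Φ)
       (∈-cartesianProductWith⁺ _∧′_
         (formulasUpTo-mono (m≤m⊔n m n) φ∈) (formulasUpTo-mono (m≤n⊔m m n) ψ∈)))))

extendBy : (Γ : FSet) (φ : Formula) → Dec (Consistent (Γ ∪ ｛ φ ｝)) → FSet
extendBy Γ φ (yes _) = Γ ∪ ｛ φ ｝
extendBy Γ φ (no _)  = Γ ∪ ｛ ¬′ φ ｝

⊆-extendBy : ∀ {Γ φ} d → Γ ⊆ extendBy Γ φ d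
⊆-extendBy (yes _) = inj₁
⊆-extendBy (no _)  = inj₁

extendBy-consistent : ∀ {Γ φ} d → Consistent Γ → Consistent (extendBy Γ φ d)
extendBy-consistent (yes conΓφ) _    = conΓφ
extendBy-consistent (no ¬conΓφ) conΓ = Consistent-∪-¬ conΓ ¬conΓφ

extendBy-decides : ∀ {Γ φ} d → extendBy Γ φ d φ ⊎ extendBy Γ φ d (¬′ φ)
extendBy-decides (yes _) = inj₁ (inj₂ refl)
extendBy-decides (no _)  = inj₂ (inj₂ refl)

module Lindenbaum (em : ExcludedMiddle 0ℓ) where

  extend : FSet → Formula → FSet
  extend Γ φ = extendBy Γ φ em

  ⊆-extendAll : ∀ {Γ} L → Γ ⊆ foldl extend Γ L
  ⊆-extendAll []      = λ Γφ → Γφ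
  ⊆-extendAll (_ ∷ L) = λ Γφ → ⊆-extendAll L (⊆-extendBy em Γφ)

  extendAll-consistent : ∀ {Γ} L → Consistent Γ → Consistent (foldl extend Γ L)
  extendAll-consistent []      conΓ = conΓ
  extendAll-consistent (_ ∷ L) conΓ = extendAll-consistent L (extendBy-consistent em conΓ)

  extendAll-decides : ∀ {Γ φ} L → φ ∈ L → foldl extend Γ L φ ⊎ foldl extend Γ L (¬′ φ)
  extendAll-decides (_ ∷ L) (here refl) with extendBy-decides em
  ... | inj₁ Γφ  = inj₁ (⊆-extendAll L Γφ)
  ... | inj₂ Γ¬φ = inj₂ (⊆-extendAll L Γ¬φ)
  extendAll-decides (_ ∷ L) (there φ∈L) = extendAll-decides L φ∈L

  stage : FSet → ℕ → FSet
  stage Γ zero    = Γ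
  stage Γ (suc n) = foldl extend (stage Γ n) (formulasUpTo n)

  limit : FSet → FSet
  limit Γ = ⋃ ℕ (stage Γ)

  limit-consistent : ∀ {Γ} → Consistent Γ → Consistent (limit Γ)
  limit-consistent {Γ} conΓ =
    ⋃-chain-consistent (stage Γ) (λ n → ⊆-extendAll (formulasUpTo n)) stage-consistent
    where
    stage-consistent : ∀ n → Consistent (stage Γ n)
    stage-consistent zero    = conΓ
    stage-consistent (suc n) = extendAll-consistent (formulasUpTo n) (stage-consistent n)

  limit-decides : ∀ {Γ} φ → limit Γ φ ⊎ limit Γ (¬′ φ)
  limit-decides {Γ} φ with formulasUpTo-complete φ
  ... | n , φ∈ with extendAll-decides {stage Γ n} (formulasUpTo n) φ∈
  ...   | inj₁ Γφ  = inj₁ (suc n , Γφ)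
  ...   | inj₂ Γ¬φ = inj₂ (suc n , Γ¬φ)

  lindenbaum : ∀ {Γ} → Consistent Γ → Σ Sᶜ λ s → ∀ φ → Γ φ → φ ∈ₛ s
  lindenbaum {Γ} conΓ = (limit Γ , limit-consistent conΓ , maximal) , λ _ Γφ → 0 , Γφ
    where
    maximal : (Γ′ : FSet) → (∀ φ → limit Γ φ → Γ′ φ) → Consistent Γ′ → ∀ φ → Γ′ φ → limit Γ φ
    maximal Γ′ limit⊆Γ′ conΓ′ φ Γ′φ with limit-decides φ
    ... | inj₁ limitφ  = limitφ
    ... | inj₂ limit¬φ =
      ⊥-elim (conΓ′ (⊢ᶠ-contradiction (⊢ᶠ-assumption Γ′φ) (⊢ᶠ-assumption (limit⊆Γ′ _ limit¬φ))))

  truthSet-⊆⇒⊢ : ∀ χ φ → ∣ χ ∣ ⊆ₛ ∣ φ ∣ → ⊢ (χ ⇒′ φ)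
  truthSet-⊆⇒⊢ χ φ χ⊆φ with em {⊢ (χ ⇒′ φ)}
  ... | yes ⊢χ⇒φ = ⊢χ⇒φ
  ... | no ⊬χ⇒φ  =
    let (s , χ∧¬φ∈s) = lindenbaum con
        χ∧¬φ∈ = χ∧¬φ∈s _ (inj₂ refl)
        χ∈  = mcs-closed s χ∧¬φ∈ (⊢-⇒-taut λ _ ⊨χ∧¬φ → proj₁ (⊨-∧⁻ ⊨χ∧¬φ))
        ¬φ∈ = mcs-closed s χ∧¬φ∈ (⊢-⇒-taut λ _ ⊨χ∧¬φ → proj₂ (⊨-∧⁻ ⊨χ∧¬φ))
    in ⊥-elim (proj₁ (proj₂ s)
         (⊢ᶠ-contradiction (⊢ᶠ-assumption (χ⊆φ s χ∈)) (⊢ᶠ-assumption ¬φ∈)))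
    where
    -- ¬′ (χ ∧′ ¬′ φ) is literally χ ⇒′ φ.
    con : Consistent (∅ ∪ ｛ χ ∧′ ¬′ φ ｝)
    con inc = ⊬χ⇒φ (⊢ᶠ-∅ (deduction inc))

mainTheorem12 : ({ℓ : Level} → ExcludedMiddle ℓ) →
    (s : Sᶜ) (φ : Formula) →
      (Nᶜ⁺ s ∣ φ ∣ → (∀ ψ → Δ (φ ∨′ ψ) ∈ₛ s)) × ((∀ ψ → Δ (φ ∨′ ψ) ∈ₛ s) → Nᶜ⁺ s ∣ φ ∣)
mainTheorem12 em s φ = Nᶜ⁺⇒Δ∨ , Δ∨⇒Nᶜ
  where
  open Lindenbaum em

  Nᶜ⁺⇒Δ∨ : Nᶜ⁺ s ∣ φ ∣ → ∀ ψ → Δ (φ ∨′ ψ) ∈ₛ s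
  Nᶜ⁺⇒Δ∨ (Y , (χ , (_ , χ⊆Y) , Δχ∨∈s) , Y⊆φ) ψ =
    mcs-closed s (Δχ∨∈s (φ ∨′ ψ)) (⊢-⇔⇒⇒ (reΔ (⊢-∨-absorb ⊢χ⇒φ)))
    where
    ⊢χ⇒φ : ⊢ (χ ⇒′ φ)
    ⊢χ⇒φ = truthSet-⊆⇒⊢ χ φ λ t χ∈t → Y⊆φ t (χ⊆Y t χ∈t)

  Δ∨⇒Nᶜ : (∀ ψ → Δ (φ ∨′ ψ) ∈ₛ s) → Nᶜ⁺ s ∣ φ ∣
  Δ∨⇒Nᶜ Δφ∨∈s = ∣ φ ∣ , (φ , ((λ _ φ∈ → φ∈) , (λ _ φ∈ → φ∈)) , Δφ∨∈s) , λ _ φ∈ → φ∈
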